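{- Let $T$ be a non-empty finite set of positive integers and let $c=\max T$. Then there exists $K$ such that for every integer $k \ge K$, the $S$-LID sequence $(a_n)_{n\ge1}$ for $S = [k]\setminus (k-T)$ satisfies \[ a_{n+1} \ =\ a_n + a_{n-k} \] for all integers $n > k+c$.
   Context: $[k]=\{1,2,\dots,k\}$ and $k-T=\{k-t : t\in T\}$. For a set $S$ of positive integers, the $S$-legal index difference ($S$-LID) sequence $(a_n)_{n\ge 1}$ is defined recursively: for each positive integer $n$, $a_n$ is the smallest positive integer that cannot be written as $\sum_{\ell\in L} a_\ell$ for some set $L \subseteq \{1,\dots,n-1\}$ such that $|i-j|\notin S$ for all $i,j\in L$ (the empty sum is $0$). -}

module Defs where

open import Data.Nat using (ℕ; zero; suc; _+_; _≤_; _<_; _⊔_; ∣_-_∣)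
open import Data.List using (List; map; foldr)
open import Data.Nat.ListAction using (sum)
open import Data.List.Relation.Unary.All using (All)
open import Data.List.Relation.Unary.Any using (Any)
open import Data.List.Relation.Unary.Unique.Propositional using (Unique)
open import Data.List.Membership.Propositional using (_∈_)
open import Data.Product using (Σ; _×_; ∃)
open import Relation.Nullary using (¬_)
open import Relation.Binary.PropositionalEquality using (_≡_)

PSet : Set₁
PSet = ℕ → Set

maxList : List ℕ → ℕ
maxList = foldr _⊔_ 0

-- S = [k] \ (k - T), for T a finite set of positive integers given as a list.
-- s ∈ k - T  iff  s = k - t for some t ∈ T, i.e. s + t = k (as integers).
legalS : ℕ → List ℕ → PSet
legalS k T s = (1 ≤ s × s ≤ k) × ¬ Any (λ t → s + t ≡ k) T

Representable : PSet → (ℕ → ℕ) → ℕ → ℕ → Set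
Representable S a n m =
  Σ (List ℕ) λ L →
    Unique L
    × All (λ i → 1 ≤ i × i < n) L
    × (∀ {i j} → i ∈ L → j ∈ L → ¬ S ∣ i - j ∣)
    × sum (map a L) ≡ m

-- a (indexed from 1; the value a 0 is irrelevant) is the S-LID sequence:
-- for every n ≥ 1, a n is the smallest positive integer not representable
-- using a_1, …, a_{n-1}.
IsLID : PSet → (ℕ → ℕ) → Set
IsLID S a = ∀ n → 1 ≤ n →
  (1 ≤ a n)
  × ¬ Representable S a n (a n)
  × (∀ m → 1 ≤ m → m < a n → Representable S a n m)

-- Write k = d + c with c = max T.  For S = [k] \ (k - T) every positive distance
-- below d is forbidden, the distance k is forbidden and every distance above k is
-- allowed.  Hence a is strictly increasing; the other indices of an admissible set
-- with top index m lie at most m - d; and adjoining n to a representation of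
-- a (n+1) - a n from indices below n - k gives a (n+1) ≥ a n + a (n - k).
-- For the converse, strong induction shows that wherever the recurrence already
-- holds, a (x+c+2) ≤ a x + a (x+1) and every admissible sum with indices at most
-- x + c stays below a x + a (x+1).  In the initial range these follow from a i = i
-- for i ≤ d + 1 and the slow growth a (i+1) ≤ a i + (i - d + 1) up to 2d, which is
-- why d must exceed a quadratic in c.  So a representation of a n + a (n-k) from
-- indices ≤ n must use n; the rest then sums to a (n-k) and so contains n - k,
-- which lies at the forbidden distance k from n.

module Submission where

open import Defs
open import Relation.Binary.PropositionalEquality using (_≡_; _≢_; refl; sym; trans; cong; cong₂; subst; subst₂; setoid)
open import Data.Nat using (ℕ; zero; suc; _+_; _*_; _∸_; _≤_; _<_; _>_; ∣_-_∣; z≤n; s≤s; s≤s⁻¹; _≤?_)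
open import Data.Nat.Properties
open import Data.Nat.Induction using (<-rec)
open import Data.Nat.ListAction using (sum)
open import Data.Nat.ListAction.Properties using (sum-↭)
open import Data.Nat.Tactic.RingSolver using (solve)
open import Algebra.Properties.CommutativeSemigroup +-commutativeSemigroup using (interchange)
open import Data.List using (List; []; _∷_; [_]; _++_; map)
open import Data.List.Relation.Unary.All as All using (All)
open import Data.List.Relation.Unary.Any using (here; there)
import Data.List.Relation.Unary.AllPairs as AllPairs
open import Data.List.Relation.Unary.Unique.Propositional using (Unique)
open import Data.List.Membership.Propositional using (_∈_; find)
open import Data.List.Membership.Propositional.Properties using (∈-∃++; ∈-map⁺)
open import Data.List.Membership.DecPropositional _≟_ using (_∈?_)
open import Data.List.Relation.Binary.Permutation.Propositional using (_↭_; ↭-sym; ↭⇒↭ₛ)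
open import Data.List.Relation.Binary.Permutation.Propositional.Properties using (shift; map⁺; All-resp-↭; ∈-resp-↭)
open import Data.List.Relation.Binary.Permutation.Setoid.Properties (setoid ℕ) using (Unique-resp-↭)
open import Data.Product using (∃; _×_; _,_; proj₁; proj₂)
open import Data.Sum using (inj₁; inj₂)
open import Data.Empty using (⊥-elim)
open import Function using (case_of_; _∘′_)
open import Relation.Nullary using (¬_; yes; no)

∈⇒≤sum : ∀ {n ns} → n ∈ ns → n ≤ sum ns
∈⇒≤sum {ns = n ∷ _} (here refl) = m≤m+n n _
∈⇒≤sum {ns = m ∷ _} (there n∈ns) = ≤-trans (∈⇒≤sum n∈ns) (m≤n+m _ m)

∈⇒≤maxList : ∀ {n ns} → n ∈ ns → n ≤ maxList ns
∈⇒≤maxList {ns = n ∷ _} (here refl) = m≤m⊔n n _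
∈⇒≤maxList {ns = m ∷ _} (there n∈ns) = ≤-trans (∈⇒≤maxList n∈ns) (m≤n⊔m m _)

suc[m]∸n≤suc[m∸n] : ∀ m n → suc m ∸ n ≤ suc (m ∸ n)
suc[m]∸n≤suc[m∸n] m       zero    = ≤-refl
suc[m]∸n≤suc[m∸n] zero    (suc n) = subst (_≤ 1) (sym (0∸n≡0 n)) z≤n
suc[m]∸n≤suc[m∸n] (suc m) (suc n) = suc[m]∸n≤suc[m∸n] m n

∈⇒↭∷ : ∀ {A : Set} {x : A} {xs} → x ∈ xs → ∃ λ ys → xs ↭ x ∷ ys
∈⇒↭∷ x∈xs with ys , zs , refl ← ∈-∃++ x∈xs = ys ++ zs , shift _ ys zs

threshold : ℕ → ℕ
threshold c = suc c * (3 * c + 7)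

module LIDSequence (S : PSet) (0∉S : ¬ S 0) (a : ℕ → ℕ) (lid : IsLID S a) where

  InRange : ℕ → ℕ → Set
  InRange n i = 1 ≤ i × i < n

  record Admissible (n : ℕ) (L : List ℕ) : Set where
    field
      unique  : Unique L
      inRange : All (InRange n) L
      spread  : ∀ {i j} → i ∈ L → j ∈ L → ¬ S ∣ i - j ∣

  open Admissible

  Σa : List ℕ → ℕ
  Σa L = sum (map a L)

  SumsBelow : ℕ → ℕ → Set
  SumsBelow n V = ∀ L → Admissible n L → Σa L < V

  toRepresentable : ∀ {n L} → Admissible n L → Representable S a n (Σa L)
  toRepresentable {L = L} adm = L , unique adm , inRange adm , spread adm , refl

  fromRepresentable : ∀ {n m} → Representable S a n m → ∃ λ L → Admissible n L × Σa L ≡ m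
  fromRepresentable (L , u , r , g , e) = L , record { unique = u ; inRange = r ; spread = g } , e

  []-admissible : ∀ {n} → Admissible n []
  []-admissible = record { unique = AllPairs.[] ; inRange = All.[] ; spread = λ () }

  admissible-within : ∀ {n n' L} → (∀ {j} → j ∈ L → j < n') → Admissible n L → Admissible n' L
  admissible-within below adm = record
    { unique  = unique adm
    ; inRange = All.tabulate λ j∈L → proj₁ (All.lookup (inRange adm) j∈L) , below j∈L
    ; spread  = spread adm
    }

  admissible-mono : ∀ {n n' L} → n ≤ n' → Admissible n L → Admissible n' L
  admissible-mono n≤n' adm =
    admissible-within (λ j∈L → <-≤-trans (proj₂ (All.lookup (inRange adm) j∈L)) n≤n') adm

  admissible-↭ : ∀ {n L L'} → L ↭ L' → Admissible n L → Admissible n L'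
  admissible-↭ L↭L' adm = record
    { unique  = Unique-resp-↭ (↭⇒↭ₛ L↭L') (unique adm)
    ; inRange = All-resp-↭ L↭L' (inRange adm)
    ; spread  = λ i∈L' j∈L' → spread adm (∈-resp-↭ (↭-sym L↭L') i∈L') (∈-resp-↭ (↭-sym L↭L') j∈L')
    }

  Apart : ℕ → List ℕ → Set
  Apart y ys = ∀ {j} → j ∈ ys → y ≢ j × ¬ S ∣ y - j ∣

  ∷-admissible : ∀ {n y ys} → InRange n y → Apart y ys → Admissible n ys → Admissible n (y ∷ ys)
  ∷-admissible {y = y} y-in apart adm = record
    { unique  = All.tabulate (proj₁ ∘′ apart) AllPairs.∷ unique adm
    ; inRange = y-in All.∷ inRange adm
    ; spread  = spread′
    }
    where
    spread′ : ∀ {i j} → i ∈ y ∷ _ → j ∈ y ∷ _ → ¬ S ∣ i - j ∣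
    spread′ (here refl) (here refl)  = subst (¬_ ∘′ S) (sym (∣n-n∣≡0 y)) 0∉S
    spread′ (here refl) (there j∈ys) = proj₂ (apart j∈ys)
    spread′ (there i∈ys) (here refl) = subst (¬_ ∘′ S) (∣-∣-comm y _) (proj₂ (apart i∈ys))
    spread′ (there i∈ys) (there j∈ys) = spread adm i∈ys j∈ys

  ∷-admissible⁻ : ∀ {n y ys} → Admissible n (y ∷ ys) → Apart y ys × Admissible n ys
  ∷-admissible⁻ adm with y≢ AllPairs.∷ u ← unique adm | _ All.∷ r ← inRange adm =
    (λ j∈ys → All.lookup y≢ j∈ys , spread adm (here refl) (there j∈ys)) ,
    record { unique = u ; inRange = r ; spread = λ i∈ys j∈ys → spread adm (there i∈ys) (there j∈ys) }

  remove : ∀ {n L y} → Admissible n L → y ∈ L → ∃ λ ys → Apart y ys × Admissible n ys × Σa L ≡ a y + Σa ys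
  remove adm y∈L with ys , L↭ ← ∈⇒↭∷ y∈L with apart , adm′ ← ∷-admissible⁻ (admissible-↭ L↭ adm) =
    ys , apart , adm′ , sum-↭ (map⁺ a L↭)

  SumsBelow⇒positive : ∀ {n V} → SumsBelow n V → 1 ≤ V
  SumsBelow⇒positive bound = bound [] []-admissible

  SumsBelow-restrict : ∀ {n n' V} → n' ≤ n → SumsBelow n V → SumsBelow n' V
  SumsBelow-restrict n'≤n bound L adm = bound L (admissible-mono n'≤n adm)

  SumsBelow-weaken : ∀ {n V V'} → V ≤ V' → SumsBelow n V → SumsBelow n V'
  SumsBelow-weaken V≤V' bound L adm = <-≤-trans (bound L adm) V≤V'

  SumsBelow-≤1 : ∀ {n V} → n ≤ 1 → 1 ≤ V → SumsBelow n V
  SumsBelow-≤1 n≤1 V≥1 []      _   = V≥1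
  SumsBelow-≤1 n≤1 V≥1 (_ ∷ _) adm with (1≤i , i<n) All.∷ _ ← inRange adm =
    ⊥-elim (<⇒≱ (<-≤-trans i<n n≤1) 1≤i)

  a-positive : ∀ {n} → 1 ≤ n → 1 ≤ a n
  a-positive n≥1 = proj₁ (lid _ n≥1)

  a-unrepresentable : ∀ {n} → 1 ≤ n → ¬ Representable S a n (a n)
  a-unrepresentable n≥1 = proj₁ (proj₂ (lid _ n≥1))

  below-a-representable : ∀ {n m} → 1 ≤ n → 1 ≤ m → m < a n → Representable S a n m
  below-a-representable n≥1 = proj₂ (proj₂ (lid _ n≥1)) _

  ¬admissible-a : ∀ {n L} → 1 ≤ n → Admissible n L → Σa L ≢ a n
  ¬admissible-a n≥1 adm Σ≡a = a-unrepresentable n≥1 (subst (Representable S a _) Σ≡a (toRepresentable adm))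

  a≤ : ∀ {n V} → 1 ≤ n → SumsBelow n V → a n ≤ V
  a≤ n≥1 bound = ≮⇒≥ λ V<a →
    let L , adm , Σ≡V = fromRepresentable (below-a-representable n≥1 (SumsBelow⇒positive bound) V<a)
    in <-irrefl Σ≡V (bound L adm)

  singleton-admissible : ∀ {n} → 1 ≤ n → Admissible (suc n) [ n ]
  singleton-admissible n≥1 = ∷-admissible (n≥1 , ≤-refl) (λ ()) []-admissible

  a-<-suc : ∀ {n} → 1 ≤ n → a n < a (suc n)
  a-<-suc {n} n≥1 = ≰⇒> λ a[n+1]≤a[n] → case m≤n⇒m<n∨m≡n a[n+1]≤a[n] of λ where
    (inj₁ a[n+1]<a[n]) →
      let L , adm , Σ≡ = fromRepresentable (below-a-representable n≥1 (a-positive (s≤s z≤n)) a[n+1]<a[n])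
      in ¬admissible-a (s≤s z≤n) (admissible-mono (n≤1+n n) adm) Σ≡
    (inj₂ a[n+1]≡a[n]) →
      ¬admissible-a (s≤s z≤n) (singleton-admissible n≥1) (trans (+-identityʳ (a n)) (sym a[n+1]≡a[n]))

  a-strictMono : ∀ {i j} → 1 ≤ i → i < j → a i < a j
  a-strictMono {i} {suc j} i≥1 (s≤s i≤j) with m≤n⇒m<n∨m≡n i≤j
  ... | inj₁ i<j  = <-trans (a-strictMono i≥1 i<j) (a-<-suc (≤-trans i≥1 i≤j))
  ... | inj₂ refl = a-<-suc i≥1

  a-mono : ∀ {i j} → 1 ≤ i → i ≤ j → a i ≤ a j
  a-mono i≥1 i≤j with m≤n⇒m<n∨m≡n i≤j
  ... | inj₁ i<j  = <⇒≤ (a-strictMono i≥1 i<j)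
  ... | inj₂ refl = ≤-refl

  n≤a : ∀ {n} → 1 ≤ n → n ≤ a n
  n≤a {suc zero}    _ = a-positive (s≤s z≤n)
  n≤a {suc (suc n)} _ = <-≤-trans (s≤s (n≤a (s≤s z≤n))) (a-<-suc (s≤s z≤n))

  Σa≡a⇒∈ : ∀ {n m L} → 1 ≤ m → Admissible n L → Σa L ≡ a m → m ∈ L
  Σa≡a⇒∈ {m = m} {L} m≥1 adm Σ≡a with m ∈? L
  ... | yes m∈L = m∈L
  ... | no  m∉L = ⊥-elim (¬admissible-a m≥1 (admissible-within below-m adm) Σ≡a)
    where
    below-m : ∀ {j} → j ∈ L → j < m
    below-m {j} j∈L = ≤∧≢⇒< (≮⇒≥ λ m<j → <⇒≱ (a-strictMono m≥1 m<j) a[j]≤a[m]) (λ { refl → m∉L j∈L })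
      where
      a[j]≤a[m] : a j ≤ a m
      a[j]≤a[m] = subst (a j ≤_) Σ≡a (∈⇒≤sum (∈-map⁺ a j∈L))

  below-top : ∀ {m L j} → Admissible (suc m) L → j ∈ L → j ≢ m → j < m
  below-top adm j∈L j≢m = ≤∧≢⇒< (s≤s⁻¹ (proj₂ (All.lookup (inRange adm) j∈L))) j≢m

  admissible-∉ : ∀ {m L} → Admissible (suc m) L → ¬ m ∈ L → Admissible m L
  admissible-∉ adm m∉L = admissible-within (λ j∈L → below-top adm j∈L λ { refl → m∉L j∈L }) adm

  module Gap (d : ℕ) (gap : ∀ {s} → 1 ≤ s → s < d → S s) where

    apart-below : ∀ {y j} → j < y → ¬ S ∣ y - j ∣ → j < suc y ∸ d
    apart-below {y} {j} j<y ¬S =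
      m+n≤o⇒m≤o∸n (suc j) (s≤s (subst (_≤ y) (+-comm d j) (m≤o∸n⇒m+n≤o d (<⇒≤ j<y) d≤y∸j)))
      where
      d≤y∸j : d ≤ y ∸ j
      d≤y∸j = ≮⇒≥ λ y∸j<d → ¬S (subst S (sym (m≤n⇒∣n-m∣≡n∸m (<⇒≤ j<y))) (gap (m+n≤o⇒m≤o∸n 1 j<y) y∸j<d))

    step : ∀ m {V} → SumsBelow (suc m ∸ d) V → SumsBelow (suc m) (a m + V)
    earlier : ∀ m {V} → SumsBelow (suc m ∸ d) V → SumsBelow m (a m + V)

    step m {V} bound L adm with m ∈? L
    ... | no m∉L = earlier m bound L (admissible-∉ adm m∉L)
    ... | yes m∈L with ys , apart , adm′ , Σ≡ ← remove adm m∈L =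
      subst (_< a m + V) (sym Σ≡) (+-monoʳ-< (a m) (bound ys (admissible-within far adm′)))
      where
      far : ∀ {j} → j ∈ ys → j < suc m ∸ d
      far j∈ys with m≢j , ¬S ← apart j∈ys = apart-below (below-top adm′ j∈ys (m≢j ∘′ sym)) ¬S

    -- m ≤ 1 is treated apart since a 0 is unconstrained.
    earlier zero          bound = SumsBelow-≤1 z≤n (≤-trans (SumsBelow⇒positive bound) (m≤n+m _ _))
    earlier (suc zero)    bound = SumsBelow-≤1 ≤-refl (≤-trans (SumsBelow⇒positive bound) (m≤n+m _ _))
    earlier (suc (suc m)) {V} bound =
      SumsBelow-weaken (+-monoˡ-≤ V (a-mono (s≤s z≤n) (n≤1+n _)))
        (step (suc m) (SumsBelow-restrict (∸-monoˡ-≤ d (n≤1+n _)) bound))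

    initial : ∀ m → m ≤ d → SumsBelow (suc m) (suc m)
    initial zero    _   = SumsBelow-≤1 ≤-refl ≤-refl
    initial (suc m) m<d = SumsBelow-weaken a[m+1]+1≤ (step (suc m) (SumsBelow-≤1 m+2∸d≤1 ≤-refl))
      where
      m+2∸d≤1 : suc (suc m) ∸ d ≤ 1
      m+2∸d≤1 = subst (suc (suc m) ∸ d ≤_) (m+n∸n≡m 1 d) (∸-monoˡ-≤ d (s≤s m<d))
      a[m+1]+1≤ : a (suc m) + 1 ≤ suc (suc m)
      a[m+1]+1≤ = subst (_≤ suc (suc m)) (+-comm 1 (a (suc m)))
                    (s≤s (a≤ (s≤s z≤n) (initial m (≤-trans (n≤1+n m) m<d))))

    a-suc≤ : ∀ {i} → 1 ≤ i → suc i ≤ d + d → a (suc i) ≤ a i + suc (i ∸ d)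
    a-suc≤ {i} i≥1 i<2d =
      a≤ (s≤s z≤n) (step i (SumsBelow-restrict (suc[m]∸n≤suc[m∸n] i d) (initial (i ∸ d) i∸d≤d)))
      where
      i∸d≤d : i ∸ d ≤ d
      i∸d≤d = subst (i ∸ d ≤_) (m+n∸n≡m d d) (∸-monoˡ-≤ d (<⇒≤ i<2d))

    a-+≤ : ∀ {i} m → 1 ≤ i → i + m ≤ d + d → a (i + m) ≤ a i + m * suc (i + m ∸ d)
    a-+≤ {i} zero    _   _ rewrite +-identityʳ i = m≤m+n (a i) 0
    a-+≤ {i} (suc m) i≥1 i+m<2d rewrite +-suc i m = begin
      a (suc (i + m))                          ≤⟨ a-suc≤ (≤-trans i≥1 (m≤m+n i m)) i+m<2d ⟩
      a (i + m) + suc (i + m ∸ d)              ≤⟨ +-mono-≤ (a-+≤ m i≥1 (<⇒≤ i+m<2d)) B′≤B ⟩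
      a i + m * suc (i + m ∸ d) + B            ≤⟨ +-monoˡ-≤ B (+-monoʳ-≤ (a i) (*-monoʳ-≤ m B′≤B)) ⟩
      a i + m * B + B                          ≡⟨ +-assoc (a i) (m * B) B ⟩
      a i + (m * B + B)                        ≡⟨ cong (a i +_) (+-comm (m * B) B) ⟩
      a i + suc m * B                          ∎
      where
      open ≤-Reasoning
      B = suc (suc (i + m) ∸ d)
      B′≤B : suc (i + m ∸ d) ≤ B
      B′≤B = s≤s (∸-monoˡ-≤ d (n≤1+n (i + m)))

  module Far (k : ℕ) (far : ∀ {s} → k < s → ¬ S s) where

    superadditive : ∀ {y} → 1 ≤ y → a (k + y) + a y ≤ a (suc (k + y))
    superadditive {y} y≥1 = ≮⇒≥ λ a[n+1]<sum →
      let x = a (suc n) ∸ a n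
          a[n]+x≡ : a n + x ≡ a (suc n)
          a[n]+x≡ = m+[n∸m]≡n (<⇒≤ a[n]<a[n+1])
          x<a[y] : x < a y
          x<a[y] = +-cancelˡ-< (a n) x (a y) (subst (_< a n + a y) (sym a[n]+x≡) a[n+1]<sum)
          L , adm , Σ≡x = fromRepresentable (below-a-representable y≥1 (m+n≤o⇒m≤o∸n 1 a[n]<a[n+1]) x<a[y])
      in ¬admissible-a (s≤s z≤n) (∷-admissible (n≥1 , ≤-refl) (apart adm) (admissible-mono y≤n+1 adm))
           (trans (cong (a n +_) Σ≡x) a[n]+x≡)
      where
      n = k + y
      n≥1 : 1 ≤ n
      n≥1 = ≤-trans y≥1 (m≤n+m y k)
      y≤n+1 : y ≤ suc n
      y≤n+1 = ≤-trans (m≤n+m y k) (n≤1+n n)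
      a[n]<a[n+1] : a n < a (suc n)
      a[n]<a[n+1] = a-<-suc n≥1
      apart : ∀ {L} → Admissible y L → Apart n L
      apart adm {j} j∈L = (λ { refl → <⇒≱ j<y (m≤n+m y k) }) , far-apart
        where
        j<y : j < y
        j<y = proj₂ (All.lookup (inRange adm) j∈L)
        far-apart : ¬ S ∣ n - j ∣
        far-apart = subst (¬_ ∘′ S) (sym (m≤n⇒∣n-m∣≡n∸m (≤-trans (<⇒≤ j<y) (m≤n+m y k))))
                      (far (m+n≤o⇒m≤o∸n (suc k) (subst (_≤ n) (+-suc k j) (+-monoʳ-≤ k j<y))))

  -- For S = [k] \ (k - T) these hypotheses hold with c = max T and d = k - c.
  module Recurrence (c d : ℕ) (c≥1 : 1 ≤ c) (d-large : threshold c ≤ d)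
                    (gap : ∀ {s} → 1 ≤ s → s < d → S s) (k∈S : S (d + c))
                    (far : ∀ {s} → d + c < s → ¬ S s) where

    open Gap d gap
    open Far (d + c) far

    k : ℕ
    k = d + c

    private
      below-d : ∀ m r → m + r ≡ suc c * (3 * c + 7) → m ≤ d
      below-d m r eq = ≤-trans (m≤m+n m r) (≤-trans (≤-reflexive eq) d-large)

    3c+3≤d : 3 * c + 3 ≤ d
    3c+3≤d = below-d (3 * c + 3) (3 * c * c + 7 * c + 4) (solve (c ∷ []))

    c<k : suc c ≤ k
    c<k = +-monoˡ-≤ c (below-d 1 (3 * c * c + 10 * c + 6) (solve (c ∷ [])))

    2c≤d : 2 * c ≤ d
    2c≤d = below-d (2 * c) (3 * c * c + 8 * c + 7) (solve (c ∷ []))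

    window-constant : suc c * (2 * c) + c ≤ d
    window-constant = below-d (suc c * (2 * c) + c) (c * c + 7 * c + 7) (solve (c ∷ []))

    dominated-constant : suc c * suc (3 * c + 3) + suc (suc c) ≤ d
    dominated-constant = below-d (suc c * suc (3 * c + 3) + suc (suc c)) (2 * c + 1) (solve (c ∷ []))

    Recurs : ℕ → Set
    Recurs z = a (suc (k + z)) ≡ a (k + z) + a z

    RecursBelow : ℕ → Set
    RecursBelow z = ∀ {y} → y < z → c < y → Recurs y

    Dominated : ℕ → Set
    Dominated x = a (suc x + suc c) ≤ a x + a (suc x)

    dominated-initial : ∀ {x} → suc c ≤ x → x ≤ k + suc c → Dominated x
    dominated-initial {x} c<x x≤k+c+1 = begin
      a (suc x + suc c)                    ≤⟨ a-+≤ (suc c) (s≤s z≤n) (≤-trans top≤ (+-monoʳ-≤ d 3c+3≤d)) ⟩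
      a (suc x) + suc c * suc (top ∸ d)    ≤⟨ +-monoʳ-≤ (a (suc x)) (≤-trans growth≤x (n≤a (≤-trans (s≤s z≤n) c<x))) ⟩
      a (suc x) + a x                      ≡⟨ +-comm (a (suc x)) (a x) ⟩
      a x + a (suc x)                      ∎
      where
      open ≤-Reasoning
      top = suc x + suc c
      top≤ : top ≤ d + (3 * c + 3)
      top≤ = ≤-trans (+-monoˡ-≤ (suc c) (s≤s x≤k+c+1)) (≤-reflexive eq)
        where
        eq : suc (d + c + suc c) + suc c ≡ d + (3 * c + 3)
        eq = solve (d ∷ c ∷ [])
      growth≤x : suc c * suc (top ∸ d) ≤ x
      growth≤x with top ≤? d
      ... | yes top≤d rewrite m≤n⇒m∸n≡0 top≤d | *-identityʳ (suc c) = c<x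
      ... | no  top≰d = +-cancelʳ-≤ (suc (suc c)) _ x (begin
        suc c * suc (top ∸ d) + suc (suc c)      ≤⟨ +-monoˡ-≤ (suc (suc c)) (*-monoʳ-≤ (suc c) (s≤s top∸d≤)) ⟩
        suc c * suc (3 * c + 3) + suc (suc c)    ≤⟨ dominated-constant ⟩
        d                                        ≤⟨ <⇒≤ (≰⇒> top≰d) ⟩
        top                                      ≡⟨ sym (+-suc x (suc c)) ⟩
        x + suc (suc c)                          ∎)
        where
        top∸d≤ : top ∸ d ≤ 3 * c + 3
        top∸d≤ = subst (top ∸ d ≤_) (m+n∸m≡n d _) (∸-monoˡ-≤ d top≤)

    dominated-step : ∀ {z} → Dominated (k + z) → Dominated z →
                     Recurs z → Recurs (suc z) → Recurs (z + suc (suc c)) → Dominated (suc (k + z))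
    dominated-step {z} dom-kz dom-z rec-z rec-z+1 rec-z+c+2 = begin
      a (suc (suc (k + z)) + suc c)                        ≡⟨ cong a e₁ ⟩
      a (suc (k + (z + suc (suc c))))                      ≡⟨ rec-z+c+2 ⟩
      a (k + (z + suc (suc c))) + a (z + suc (suc c))      ≡⟨ cong₂ (λ i j → a i + a j) e₂ e₃ ⟩
      a (suc (k + z) + suc c) + a (suc z + suc c)          ≤⟨ +-mono-≤ dom-kz dom-z ⟩
      (a (k + z) + a (suc (k + z))) + (a z + a (suc z))    ≡⟨ interchange (a (k + z)) _ (a z) _ ⟩
      (a (k + z) + a z) + (a (suc (k + z)) + a (suc z))    ≡⟨ cong₂ _+_ (sym rec-z) (sym rec-z+1′) ⟩
      a (suc (k + z)) + a (suc (suc (k + z)))              ∎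
      where
      open ≤-Reasoning
      e₁ : suc (suc (d + c + z)) + suc c ≡ suc (d + c + (z + suc (suc c)))
      e₁ = solve (d ∷ c ∷ z ∷ [])
      e₂ : d + c + (z + suc (suc c)) ≡ suc (d + c + z) + suc c
      e₂ = solve (d ∷ c ∷ z ∷ [])
      e₃ : z + suc (suc c) ≡ suc z + suc c
      e₃ = solve (c ∷ z ∷ [])
      rec-z+1′ : a (suc (suc (k + z))) ≡ a (suc (k + z)) + a (suc z)
      rec-z+1′ = subst (λ i → a (suc i) ≡ a i + a (suc z)) (+-suc k z) rec-z+1

    dominated : ∀ {B} → RecursBelow B → ∀ x → suc c ≤ x → suc x + suc c ≤ k + B → Dominated x
    dominated {B} rec = <-rec _ go
      where
      rec′ : ∀ {y} → k + y < k + B → c < y → Recurs y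
      rec′ {y} lt = rec (+-cancelˡ-< k y B lt)

      go : ∀ x → (∀ {y} → y < x → suc c ≤ y → suc y + suc c ≤ k + B → Dominated y) →
           suc c ≤ x → suc x + suc c ≤ k + B → Dominated x
      go x ih c<x bound with x ≤? k + suc c
      ... | yes x≤k+c+1 = dominated-initial c<x x≤k+c+1
      ... | no  x≰k+c+1 with z , refl ← m≤n⇒∃[o]m+o≡n (≤-trans (s≤s (m≤m+n k (suc c))) (≰⇒> x≰k+c+1)) =
        dominated-step
          (ih ≤-refl (≤-trans c<z (m≤n+m z k)) (≤-trans (n≤1+n _) bound))
          (ih (s≤s (m≤n+m z k)) c<z (≤-trans (+-monoˡ-≤ (suc c) (s≤s (≤-trans (m≤n+m z k) (n≤1+n _)))) bound))
          (rec′ (≤-trans (≤-trans (n≤1+n _) (m≤m+n _ (suc c))) bound) c<z)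
          (rec′ (subst (_≤ k + B) (cong suc (sym (+-suc k z))) (≤-trans (m≤m+n _ (suc c)) bound))
                (≤-trans c<z (n≤1+n z)))
          (rec′ (subst (_≤ k + B) e bound) (≤-trans (m≤n+m (suc c) z) (+-monoʳ-≤ z (n≤1+n (suc c)))))
        where
        c<z : suc c ≤ z
        c<z = +-cancelˡ-≤ k (suc c) z (s≤s⁻¹ (≰⇒> x≰k+c+1))
        e : suc (suc (d + c + z)) + suc c ≡ suc (d + c + (z + suc (suc c)))
        e = solve (d ∷ c ∷ z ∷ [])

    shifted-window : ∀ {y} → 1 ≤ y → SumsBelow (suc (y + c)) (a y + a (suc y)) →
                     SumsBelow (suc (k + y)) (a (suc (k + y)) + a (suc y))
    shifted-window {y} y≥1 bound =
      SumsBelow-weaken (subst (_≤ a (suc (k + y)) + a (suc y)) (+-assoc (a (k + y)) (a y) (a (suc y)))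
                                (+-monoˡ-≤ (a (suc y)) (superadditive y≥1)))
        (step (k + y) (subst (λ n → SumsBelow n (a y + a (suc y))) (sym window-index) bound))
      where
      window-index : suc (d + c + y) ∸ d ≡ suc (y + c)
      window-index = trans (cong (_∸ d) e) (m+n∸m≡n d (suc (y + c)))
        where
        e : suc (d + c + y) ≡ d + suc (y + c)
        e = solve (d ∷ c ∷ y ∷ [])

    window-middle : ∀ {x} → c ≤ x → d ≤ x + c → x < k → SumsBelow (suc (x + c)) (a x + a (suc x))
    window-middle {x} c≤x d≤x+c x<k =
      SumsBelow-weaken total≤
        (step (x + c) (subst (λ n → SumsBelow n (suc e)) (sym (+-∸-assoc 1 d≤x+c)) (initial e e≤d)))
      where
      e = x + c ∸ d
      d+e≡x+c : d + e ≡ x + c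
      d+e≡x+c = m+[n∸m]≡n d≤x+c
      e<2c : suc e ≤ 2 * c
      e<2c = +-cancelˡ-≤ d (suc e) (2 * c)
               (subst₂ _≤_ (sym (trans (+-suc d e) (cong suc d+e≡x+c))) eq (+-monoˡ-≤ c x<k))
        where
        eq : d + c + c ≡ d + 2 * c
        eq = solve (d ∷ c ∷ [])
      e≤d : e ≤ d
      e≤d = ≤-trans (n≤1+n e) (≤-trans e<2c 2c≤d)
      growth≤x : suc c * (2 * c) ≤ x
      growth≤x = +-cancelʳ-≤ c _ x (≤-trans window-constant d≤x+c)
      total≤ : a (x + c) + suc e ≤ a x + a (suc x)
      total≤ = begin
        a (x + c) + suc e          ≤⟨ +-monoˡ-≤ (suc e) (a-+≤ c (≤-trans c≥1 c≤x) x+c≤2d) ⟩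
        a x + c * suc e + suc e    ≡⟨ +-assoc (a x) (c * suc e) (suc e) ⟩
        a x + (c * suc e + suc e)  ≡⟨ cong (a x +_) (+-comm (c * suc e) (suc e)) ⟩
        a x + suc c * suc e        ≤⟨ +-monoʳ-≤ (a x) (≤-trans (*-monoʳ-≤ (suc c) e<2c) growth≤a) ⟩
        a x + a (suc x)            ∎
        where
        open ≤-Reasoning
        x+c≤2d : x + c ≤ d + d
        x+c≤2d = subst (_≤ d + d) d+e≡x+c (+-monoʳ-≤ d e≤d)
        growth≤a : suc c * (2 * c) ≤ a (suc x)
        growth≤a = ≤-trans growth≤x (≤-trans (n≤1+n x) (n≤a (s≤s z≤n)))

    window : ∀ {B} → RecursBelow B → ∀ x → c ≤ x → suc x + suc c ≤ k + B →
             SumsBelow (suc (x + c)) (a x + a (suc x))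
    window {B} rec = <-rec _ go
      where
      go : ∀ x → (∀ {y} → y < x → c ≤ y → suc y + suc c ≤ k + B →
                  SumsBelow (suc (y + c)) (a y + a (suc y))) →
           c ≤ x → suc x + suc c ≤ k + B → SumsBelow (suc (x + c)) (a x + a (suc x))
      go x ih c≤x bound with x + c ≤? d
      ... | yes x+c≤d = SumsBelow-weaken
              (subst (_≤ a x + a (suc x)) (+-suc x c)
                (+-mono-≤ (n≤a (≤-trans c≥1 c≤x)) (≤-trans (s≤s c≤x) (n≤a (s≤s z≤n)))))
              (initial (x + c) x+c≤d)
      ... | no x+c≰d with k ≤? x
      ...   | no  k≰x = window-middle c≤x (<⇒≤ (≰⇒> x+c≰d)) (≰⇒> k≰x)
      ...   | yes k≤x with y , refl ← m≤n⇒∃[o]m+o≡n k≤x =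
        SumsBelow-weaken value≤
          (subst (λ n → SumsBelow (suc n) (a (suc (k + (y + c))) + a (suc (y + c)))) (sym (+-assoc k y c))
            (shifted-window (≤-trans c≥1 (m≤n+m c y)) earlier-window))
        where
        y+c<k+y : y + c < k + y
        y+c<k+y = subst₂ _≤_ (+-suc y c) (+-comm y k) (+-monoʳ-≤ y c<k)
        earlier-window : SumsBelow (suc (y + c + c)) (a (y + c) + a (suc (y + c)))
        earlier-window = ih y+c<k+y (m≤n+m c y) (≤-trans (+-monoˡ-≤ (suc c) (≤-trans y+c<k+y (n≤1+n _))) bound)
        value≤ : a (suc (k + (y + c))) + a (suc (y + c)) ≤ a (k + y) + a (suc (k + y))
        value≤ = begin
          a (suc (k + (y + c))) + a (suc (y + c))   ≡⟨ cong (λ i → a i + a (suc (y + c))) (sym (+-suc k (y + c))) ⟩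
          a (k + suc (y + c)) + a (suc (y + c))     ≤⟨ superadditive (s≤s z≤n) ⟩
          a (suc (k + suc (y + c)))                 ≡⟨ cong a e ⟩
          a (suc (k + y) + suc c)                   ≤⟨ dominated rec (k + y) (≤-trans c<k (m≤m+n k y)) bound ⟩
          a (k + y) + a (suc (k + y))               ∎
          where
          open ≤-Reasoning
          e : suc (d + c + suc (y + c)) ≡ suc (d + c + y) + suc c
          e = solve (d ∷ c ∷ y ∷ [])

    recurs-step : ∀ {z} → c < z → RecursBelow z → Recurs z
    recurs-step {suc w} (s≤s c≤w) rec = ≤-antisym upper (superadditive (s≤s z≤n))
      where
      n = k + suc w
      V = a n + a (suc w)
      below-n : SumsBelow n V
      below-n = subst (λ m → SumsBelow m (a m + a (suc w))) (sym (+-suc k w))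
                  (shifted-window (≤-trans c≥1 c≤w) (window rec w c≤w w+c+2≤k+w+1))
        where
        w+c+2≤k+w+1 : suc w + suc c ≤ k + suc w
        w+c+2≤k+w+1 = subst (_≤ k + suc w) (+-comm (suc c) (suc w)) (+-monoˡ-≤ (suc w) c<k)
      distance : ∣ n - suc w ∣ ≡ k
      distance = trans (m≤n⇒∣n-m∣≡n∸m (m≤n+m (suc w) k)) (m+n∸n≡m k (suc w))
      no-representation : ∀ {L} → Admissible (suc n) L → Σa L ≢ V
      no-representation {L} adm Σ≡V with n ∈? L
      ... | no  n∉L = <-irrefl Σ≡V (below-n L (admissible-∉ adm n∉L))
      ... | yes n∈L with ys , apart , adm′ , Σ≡ ← remove adm n∈L =
        proj₂ (apart w+1∈ys) (subst S (sym distance) k∈S)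
        where
        w+1∈ys : suc w ∈ ys
        w+1∈ys = Σa≡a⇒∈ (s≤s z≤n) adm′ (+-cancelˡ-≡ (a n) _ _ (trans (sym Σ≡) Σ≡V))
      V≥1 : 1 ≤ V
      V≥1 = ≤-trans (a-positive (≤-trans (s≤s z≤n) (m≤n+m (suc w) k))) (m≤m+n _ _)
      upper : a (suc n) ≤ V
      upper = ≮⇒≥ λ V<a →
        let L , adm , Σ≡V = fromRepresentable (below-a-representable (s≤s z≤n) V≥1 V<a)
        in no-representation adm Σ≡V

    recurs : ∀ {z} → c < z → Recurs z
    recurs {z} = <-rec (λ z → c < z → Recurs z) (λ _ rec c<z → recurs-step c<z rec) z

    eventually-recurrent : ∀ {n} → k + c < n → a (suc n) ≡ a n + a (n ∸ k)
    eventually-recurrent {n} k+c<n with z , refl ← m≤n⇒∃[o]m+o≡n (≤-trans (m≤m+n k c) (<⇒≤ k+c<n)) =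
      subst (λ i → a (suc (k + z)) ≡ a (k + z) + a i) (sym (m+n∸m≡n k z)) (recurs (+-cancelˡ-< k c z k+c<n))

legalS-0 : ∀ {k T} → ¬ legalS k T 0
legalS-0 ((() , _) , _)

legalS-small : ∀ {k T s} → 1 ≤ s → s + maxList T < k → legalS k T s
legalS-small {s = s} s≥1 s+c<k = (s≥1 , ≤-trans (m≤m+n s _) (<⇒≤ s+c<k)) , λ hit →
  let t , t∈T , s+t≡k = find hit
  in <-irrefl s+t≡k (≤-<-trans (+-monoʳ-≤ s (∈⇒≤maxList t∈T)) s+c<k)

legalS-self : ∀ {k T} → 1 ≤ k → All (1 ≤_) T → legalS k T k
legalS-self {k} k≥1 T-pos = (k≥1 , ≤-refl) , λ hit →
  let t , t∈T , k+t≡k = find hit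
  in <-irrefl (sym k+t≡k) (m<m+n k (All.lookup T-pos t∈T))

legalS-large : ∀ {k T s} → k < s → ¬ legalS k T s
legalS-large k<s ((_ , s≤k) , _) = <⇒≱ k<s s≤k

theorem1p12 : (t₀ : ℕ) (ts : List ℕ) → All (λ t → 1 ≤ t) (t₀ ∷ ts) →
    ∃ λ K → ∀ k → K ≤ k →
      ∀ (a : ℕ → ℕ) → IsLID (legalS k (t₀ ∷ ts)) a →
        ∀ n → n > k + maxList (t₀ ∷ ts) →
          a (n + 1) ≡ a n + a (n ∸ k)
theorem1p12 t₀ ts T-pos = threshold c + c , λ k K≤k →
  subst (λ k → ∀ a → IsLID (legalS k T) a → ∀ n → n > k + c → a (n + 1) ≡ a n + a (n ∸ k))
        (m∸n+n≡m (m+n≤o⇒n≤o (threshold c) K≤k))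
        (recurrence (k ∸ c) (m+n≤o⇒m≤o∸n (threshold c) K≤k))
  where
  T = t₀ ∷ ts
  c = maxList T
  c≥1 : 1 ≤ c
  c≥1 = ≤-trans (All.lookup T-pos (here refl)) (∈⇒≤maxList {ns = T} (here refl))
  recurrence : ∀ d → threshold c ≤ d → ∀ a → IsLID (legalS (d + c) T) a →
               ∀ n → n > d + c + c → a (n + 1) ≡ a n + a (n ∸ (d + c))
  recurrence d d-large a lid n n> = trans (cong a (+-comm n 1)) (eventually-recurrent n>)
    where
    open LIDSequence (legalS (d + c) T) legalS-0 a lid
    open Recurrence c d c≥1 d-large (λ s≥1 s<d → legalS-small {T = T} s≥1 (+-monoˡ-< c s<d))
                    (legalS-self (≤-trans c≥1 (m≤n+m c d)) T-pos) legalS-large
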